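{- Let $\varphi=\varphi_1\wedge\dots\wedge\varphi_{13}$ and $\chi$ be the first-order sentences with counting quantifiers listed in the context. If $\mathfrak{A}\models\varphi$, then $\mathfrak{A}$ is grid-like. If in addition $\mathfrak{A}\models\chi$, then $\mathfrak{A}$ is an $\mathbb{N}\times\mathbb{N}$-grid.
   Context: Signature: unary $G,O$; binary $H,V,E_H,E_V,\preceq_H,\preceq_V$ (written infix); ternary $C_H,C_V$; quaternary $R_H,R_V,S_H,S_V$; no equality is used. $\exists_{[=1]}x$ means "exactly one $x$", $\exists_{[\le1]}x$ "at most one $x$", and $\exists_{[0^{+1}]}x$ "finitely many $x$". $X,Y$ range over $\{H,V\}$. $\varphi_1$: $\exists_{[=1]}x\,O(x)\wedge\forall x(O(x)\to\neg G(x))$. $\varphi_2$: $\forall x(O(x)\to\forall y(\neg E_H(y,x)\wedge\neg E_V(y,x)))$. $\varphi_3$: $\exists_{[=1]}x(G(x)\wedge\forall y(\neg E_H(x,y)\wedge\neg E_V(x,y)))$. $\varphi_4$: $\forall x(G(x)\to(\exists_{[=1]}y(H(x,y)\wedge G(y))\wedge\exists_{[=1]}y(V(x,y)\wedge G(y))))$. $\varphi_5$: $\bigwedge_X\forall x\forall y\forall z(((E_X(y,x)\vee O(x))\wedge X(y,z))\to\exists_{[=1]}w(E_X(z,w)\wedge S_X(x,y,z,w)))$. $\varphi_6$: $\bigwedge_X\forall w\forall z\forall y((E_X(z,w)\wedge X(y,z))\to\exists_{[=1]}x((E_X(y,x)\vee O(x))\wedge S_X(x,y,z,w)))$. $\varphi_7$: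 $\bigwedge_{X\ne Y}\forall x\forall y(X(x,y)\to(x\preceq_Y y\wedge y\preceq_Y x))$. $\varphi_8$: $\bigwedge_X\forall x\forall y((G(x)\wedge G(y))\to(x\preceq_X y\vee y\preceq_X x))$. $\varphi_9$: $\bigwedge_X\forall x\forall y\forall z((y\preceq_X z\wedge E_X(y,x))\to\exists_{[=1]}w(E_X(z,w)\wedge R_X(x,y,z,w)))$. $\varphi_{10}$: $\bigwedge_X\forall w\forall z\forall y((y\preceq_X z\wedge E_X(z,w))\to\exists_{[\le1]}x(E_X(y,x)\wedge R_X(x,y,z,w)))$. $\varphi_{11}$: $\bigwedge_X\forall w\forall z\forall y(C_X(w,z,y)\leftrightarrow\exists_{[=1]}x(E_X(y,x)\wedge R_X(x,y,z,w)))$. $\varphi_{12}$: $\bigwedge_X\forall y\forall z((G(y)\wedge G(z)\wedge\forall w(E_X(z,w)\to C_X(w,z,y)))\to z\preceq_X y)$. $\varphi_{13}$: $\forall y(G(y)\to\exists_{[=1]}z\bigwedge_X(y\preceq_X z\wedge z\preceq_X y))$. $\chi$: $\bigwedge_X\forall x\,\exists_{[0^{+1}]}y\,E_X(x,y)$. The canonical $\mathbb{N}\times\mathbb{N}$-grid $\mathfrak{G}$ is the $\{G,H,V\}$-structure with domain $\mathbb{N}\times\mathbb{N}$, $G^{\mathfrak{G}}=\mathbb{N}\times\mathbb{N}$, $H^{\mathfrak{G}}=\{((i,j),(i,j+1))\}$, $V^{\mathfrak{G}}=\{((i,j),(i+1,j))\}$. A structure $\mathfrak{A}$ is grid-like if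 it contains a homomorphic embedding of $\mathfrak{G}$ (a map from $\mathbb{N}\times\mathbb{N}$ into $A$ preserving $G$, $H$, $V$), and is an $\mathbb{N}\times\mathbb{N}$-grid if its restriction to the elements of $G^{\mathfrak{A}}$ and to the signature $\{G,H,V\}$ is isomorphic to $\mathfrak{G}$. -}

module Defs where

open import Data.Nat using (ℕ; suc)
open import Data.Product using (Σ; _×_; _,_)
open import Data.Sum using (_⊎_)
open import Data.List using (List)
open import Data.List.Membership.Propositional using (_∈_)
open import Relation.Nullary using (¬_; Dec)
open import Relation.Binary.PropositionalEquality using (_≡_)
open import Function.Bundles using (_⇔_)

data Dir : Set where
  hor ver : Dir

-- The other direction (for X ≠ Y in φ7).
other : Dir → Dir
other hor = ver
other ver = hor

-- Symbols with a subscript X are given as Dir-indexed families: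
--   Adj hor = H, Adj ver = V, E X = E_X, Pre X = ≼_X, C X = C_X, R X = R_X, S X = S_X.
record Str : Set₁ where
  field
    A   : Set
    G   : A → Set
    O   : A → Set
    Adj : Dir → A → A → Set
    E   : Dir → A → A → Set
    Pre : Dir → A → A → Set
    C   : Dir → A → A → A → Set
    R   : Dir → A → A → A → A → Set
    S   : Dir → A → A → A → A → Set

-- Counting quantifiers (interpreted with the true equality of the domain).
ExactlyOne : {A : Set} → (A → Set) → Set
ExactlyOne {A} P = Σ A λ x → P x × (∀ y → P y → y ≡ x)

AtMostOne : {A : Set} → (A → Set) → Set
AtMostOne {A} P = ∀ x y → P x → P y → x ≡ y

FinitelyMany : {A : Set} → (A → Set) → Set
FinitelyMany {A} P = Σ (List A) λ l → ∀ y → P y → y ∈ l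

module _ (𝔄 : Str) where
  open Str 𝔄

  φ1 : Set
  φ1 = ExactlyOne O × (∀ x → O x → ¬ G x)

  φ2 : Set
  φ2 = ∀ x → O x → ∀ y → ¬ E hor y x × ¬ E ver y x

  φ3 : Set
  φ3 = ExactlyOne λ x → G x × (∀ y → ¬ E hor x y × ¬ E ver x y)

  φ4 : Set
  φ4 = ∀ x → G x →
         ExactlyOne (λ y → Adj hor x y × G y) × ExactlyOne (λ y → Adj ver x y × G y)

  φ5 : Set
  φ5 = ∀ X x y z → (E X y x ⊎ O x) × Adj X y z →
         ExactlyOne λ w → E X z w × S X x y z w

  φ6 : Set
  φ6 = ∀ X w z y → E X z w × Adj X y z →
         ExactlyOne λ x → (E X y x ⊎ O x) × S X x y z w

  φ7 : Set
  φ7 = ∀ X x y → Adj X x y → Pre (other X) x y × Pre (other X) y x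

  φ8 : Set
  φ8 = ∀ X x y → G x × G y → Pre X x y ⊎ Pre X y x

  φ9 : Set
  φ9 = ∀ X x y z → Pre X y z × E X y x →
         ExactlyOne λ w → E X z w × R X x y z w

  φ10 : Set
  φ10 = ∀ X w z y → Pre X y z × E X z w →
          AtMostOne λ x → E X y x × R X x y z w

  φ11 : Set
  φ11 = ∀ X w z y → C X w z y ⇔ ExactlyOne (λ x → E X y x × R X x y z w)

  φ12 : Set
  φ12 = ∀ X y z → G y × G z × (∀ w → E X z w → C X w z y) → Pre X z y

  φ13 : Set
  φ13 = ∀ y → G y → ExactlyOne λ z →
          (Pre hor y z × Pre hor z y) × (Pre ver y z × Pre ver z y)

  φ : Set
  φ = φ1 × φ2 × φ3 × φ4 × φ5 × φ6 × φ7 × φ8 × φ9 × φ10 × φ11 × φ12 × φ13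

  χ : Set
  χ = ∀ X x → FinitelyMany λ y → E X x y

  -- The canonical grid 𝔊 on ℕ × ℕ: H((i,j),(i,j+1)), V((i,j),(i+1,j)).
  -- Grid-like: a homomorphism from 𝔊 into 𝔄 (preserving G, H, V).
  GridLike : Set
  GridLike = Σ (ℕ → ℕ → A) λ f → ∀ i j →
               G (f i j) × Adj hor (f i j) (f i (suc j)) × Adj ver (f i j) (f (suc i) j)

GH : ℕ × ℕ → ℕ × ℕ → Set
GH (i , j) (i' , j') = i' ≡ i × j' ≡ suc j

GV : ℕ × ℕ → ℕ × ℕ → Set
GV (i , j) (i' , j') = i' ≡ suc i × j' ≡ j

module _ (𝔄 : Str) where
  open Str 𝔄

  -- 𝔄 is an ℕ×ℕ-grid: the restriction of 𝔄 to G^𝔄 and {G,H,V} is isomorphic to 𝔊,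
  -- i.e. there is a bijection f : ℕ×ℕ → G^𝔄 with H(f p, f q) ↔ 𝔊-H(p,q), same for V.
  IsGrid : Set
  IsGrid = Σ (ℕ × ℕ → A) λ f →
             (∀ p → G (f p))
           × (∀ p q → f p ≡ f q → p ≡ q)
           × (∀ a → G a → Σ (ℕ × ℕ) λ p → f p ≡ a)
           × (∀ p q → Adj hor (f p) (f q) ⇔ GH p q)
           × (∀ p q → Adj ver (f p) (f q) ⇔ GV p q)

-- The ambient metatheory of the paper is classical.
ExcludedMiddle : Set₁
ExcludedMiddle = (P : Set) → Dec P

-- Call the number of E_X-successors of a point its X-coordinate. The origin of φ3 has
-- coordinates (0, 0). An X-step raises the X-coordinate by one, since by φ5/φ6 the relation
-- S_X matches the E_X-successors of the target with those of the source plus the O-element.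
-- A Y-step keeps the X-coordinate: by φ7 source and target are ≼_X-equivalent, and by
-- φ9/φ10 the relation R_X injects the E_X-successors of y into those of z whenever y ≼_X z.
-- If two grid points have equal X-coordinates, such an injection is onto, so φ11, φ12 and
-- the totality φ8 make them ≼_X-equivalent; by φ13 two grid points with equal coordinates
-- are therefore equal. Following H- and V-steps from the origin thus traces out a grid whose
-- point (i, j) has coordinates (i, j), which makes it injective and closes the squares. Under
-- χ every point has finite coordinates, so every grid point is reached.
module Submission where

open import Defs
open import Data.Empty using (⊥-elim)
open import Data.Fin using (Fin; zero; suc; punchOut)
open import Data.Fin.Properties
  using (any?; _≟_; punchOut-injective; injective⇒≤; cantor-schröder-bernstein)
open import Data.List using (List; []; _∷_)
open import Data.List.Membership.Propositional using (_∈_)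
open import Data.List.Relation.Unary.Any using (here; there)
open import Data.Nat using (ℕ; zero; suc)
open import Data.Nat.Properties using (1+n≰n)
open import Data.Product using (Σ; ∃; _×_; _,_; proj₁; proj₂)
open import Data.Product.Properties using (,-injective)
open import Data.Sum using (inj₁; inj₂)
open import Function.Base using (case_of_)
open import Function.Bundles using (_⇔_; mk⇔; Equivalence)
open import Function.Definitions using (Injective)
open import Relation.Nullary using (¬_; yes; no)
open import Relation.Unary using (_∪_; _∩_; ∁; ｛_｝; _⊆_; _≐_)
open import Relation.Binary.PropositionalEquality
open ≡-Reasoning

injective⇒surjective : ∀ {n} {f : Fin n → Fin n} → Injective _≡_ _≡_ f →
                       ∀ k → ∃ λ l → f l ≡ k
injective⇒surjective {zero} _ ()
injective⇒surjective {suc n} {f} f-injective k with any? (λ l → f l ≟ k)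
... | yes hit = hit
... | no miss = ⊥-elim (1+n≰n (injective⇒≤ squeeze-injective))
  where
  k≢f : ∀ l → k ≢ f l
  k≢f l k≡fl = miss (l , sym k≡fl)

  squeeze : Fin (suc n) → Fin n
  squeeze l = punchOut (k≢f l)

  squeeze-injective : Injective _≡_ _≡_ squeeze
  squeeze-injective eq = f-injective (punchOut-injective (k≢f _) (k≢f _) eq)

exactlyOne⇒atMostOne : ∀ {A : Set} {P : A → Set} → ExactlyOne P → AtMostOne P
exactlyOne⇒atMostOne (_ , _ , unique) a b pa pb = trans (unique a pa) (sym (unique b pb))

module _ {A : Set} where

  -- P need not be proposition-valued, so this is not stated as Fin n ↔ Σ A P.
  record Enumeration (P : A → Set) (n : ℕ) : Set where
    field
      elem           : Fin n → A
      elem-∈         : ∀ k → P (elem k)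
      elem-injective : Injective _≡_ _≡_ elem
      index          : ∀ a → P a → Fin n
      elem-index     : ∀ a (p : P a) → elem (index a p) ≡ a

  record PredInjection (P Q : A → Set) : Set where
    field
      map           : ∀ a → P a → A
      map-∈         : ∀ a (p : P a) → Q (map a p)
      map-injective : ∀ {a b} (p : P a) (q : P b) → map a p ≡ map b q → a ≡ b

  open Enumeration
  open PredInjection

  private
    variable
      m n : ℕ
      P Q : A → Set

  id-injection : PredInjection P P
  id-injection = record { map = λ a _ → a ; map-∈ = λ _ p → p ; map-injective = λ _ _ eq → eq }

  _∘ᴵ_ : ∀ {R} → PredInjection Q R → PredInjection P Q → PredInjection P R
  κ ∘ᴵ ι = record
    { map           = λ a p → map κ (map ι a p) (map-∈ ι a p)
    ; map-∈         = λ a p → map-∈ κ (map ι a p) (map-∈ ι a p)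
    ; map-injective = λ p q eq → map-injective ι p q (map-injective κ _ _ eq)
    }

  module _ {T : A → A → Set}
           (unique-image    : ∀ a → P a → ExactlyOne λ b → Q b × T a b)
           (unique-preimage : ∀ b → Q b → AtMostOne λ a → P a × T a b) where

    relation-map : ∀ a → P a → A
    relation-map a p = proj₁ (unique-image a p)

    relation-map-∈ : ∀ a (p : P a) → Q (relation-map a p)
    relation-map-∈ a p = proj₁ (proj₁ (proj₂ (unique-image a p)))

    relation-map-rel : ∀ a (p : P a) → T a (relation-map a p)
    relation-map-rel a p = proj₂ (proj₁ (proj₂ (unique-image a p)))

    relation-injection : PredInjection P Q
    relation-injection = record
      { map           = relation-map
      ; map-∈         = relation-map-∈
      ; map-injective = λ {a} {b} p q eq →
          unique-preimage (relation-map b q) (relation-map-∈ b q) a b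
            (p , subst (T a) eq (relation-map-rel a p)) (q , relation-map-rel b q)
      }

  module _ (eP : Enumeration P m) (ι : PredInjection P Q) where

    image : Fin m → A
    image k = map ι (elem eP k) (elem-∈ eP k)

    image-∈ : ∀ k → Q (image k)
    image-∈ k = map-∈ ι (elem eP k) (elem-∈ eP k)

  module _ (eP : Enumeration P m) (eQ : Enumeration Q n) (ι : PredInjection P Q) where

    reindex : Fin m → Fin n
    reindex k = index eQ (image eP ι k) (image-∈ eP ι k)

    elem-reindex : ∀ k → elem eQ (reindex k) ≡ image eP ι k
    elem-reindex k = elem-index eQ _ _

    reindex-injective : Injective _≡_ _≡_ reindex
    reindex-injective {k} {l} eq = elem-injective eP (map-injective ι _ _ (begin
      image eP ι k          ≡⟨ elem-reindex k ⟨
      elem eQ (reindex k)   ≡⟨ cong (elem eQ) eq ⟩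
      elem eQ (reindex l)   ≡⟨ elem-reindex l ⟩
      image eP ι l          ∎))

  size-unique : Enumeration P m → Enumeration P n → m ≡ n
  size-unique e e′ = cantor-schröder-bernstein
    (reindex-injective e e′ id-injection) (reindex-injective e′ e id-injection)

  injection-surjective : (eP : Enumeration P n) → Enumeration Q n → (ι : PredInjection P Q) →
                         ∀ b → Q b → ∃ λ k → image eP ι k ≡ b
  injection-surjective eP eQ ι b q
    with k , reindex-k≡index-b ← injective⇒surjective (reindex-injective eP eQ ι) (index eQ b q)
    = k , (begin
      image eP ι k                ≡⟨ elem-reindex eP eQ ι k ⟨
      elem eQ (reindex eP eQ ι k) ≡⟨ cong (elem eQ) reindex-k≡index-b ⟩
      elem eQ (index eQ b q)      ≡⟨ elem-index eQ b q ⟩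
      b                           ∎)

  transport : Enumeration P n → PredInjection P Q → PredInjection Q P → Enumeration Q n
  transport eP ι κ = record
    { elem           = image eP ι
    ; elem-∈         = image-∈ eP ι
    ; elem-injective = λ eq → elem-injective eP (map-injective ι _ _ eq)
    ; index          = λ b q → proj₁ (back b q)
    ; elem-index     = λ b q → map-injective κ _ q (proj₂ (back b q))
    }
    where
    back : ∀ b q → ∃ λ k → image eP (κ ∘ᴵ ι) k ≡ map κ b q
    back b q = injection-surjective eP eP (κ ∘ᴵ ι) (map κ b q) (map-∈ κ b q)

  enumeration-empty : (∀ a → ¬ P a) → Enumeration P 0
  enumeration-empty ∉P = record
    { elem = λ () ; elem-∈ = λ () ; elem-injective = λ { {()} }
    ; index = λ a p → ⊥-elim (∉P a p) ; elem-index = λ a p → ⊥-elim (∉P a p) }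

  enumeration-insert : ∀ {a} → ¬ P a → Enumeration P n → Enumeration (P ∪ ｛ a ｝) (suc n)
  enumeration-insert {P = P} {n = n} {a = a} a∉P eP = record
    { elem = elem′ ; elem-∈ = elem′-∈ ; elem-injective = elem′-injective
    ; index = index′ ; elem-index = elem-index′ }
    where
    elem′ : Fin (suc n) → A
    elem′ zero    = a
    elem′ (suc k) = elem eP k

    elem′-∈ : ∀ k → (P ∪ ｛ a ｝) (elem′ k)
    elem′-∈ zero    = inj₂ refl
    elem′-∈ (suc k) = inj₁ (elem-∈ eP k)

    elem′-injective : Injective _≡_ _≡_ elem′
    elem′-injective {zero}  {zero}  _  = refl
    elem′-injective {zero}  {suc l} eq = ⊥-elim (a∉P (subst P (sym eq) (elem-∈ eP l)))
    elem′-injective {suc k} {zero}  eq = ⊥-elim (a∉P (subst P eq (elem-∈ eP k)))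
    elem′-injective {suc k} {suc l} eq = cong suc (elem-injective eP eq)

    index′ : ∀ b → (P ∪ ｛ a ｝) b → Fin (suc n)
    index′ b (inj₁ p)    = suc (index eP b p)
    index′ _ (inj₂ refl) = zero

    elem-index′ : ∀ b p → elem′ (index′ b p) ≡ b
    elem-index′ b (inj₁ p)    = elem-index eP b p
    elem-index′ _ (inj₂ refl) = refl

  enumeration-resp : P ≐ Q → Enumeration P n → Enumeration Q n
  enumeration-resp (P⊆Q , Q⊆P) eP = record
    { elem = elem eP ; elem-∈ = λ k → P⊆Q (elem-∈ eP k) ; elem-injective = elem-injective eP
    ; index = λ a q → index eP a (Q⊆P q) ; elem-index = λ a q → elem-index eP a (Q⊆P q) }

  covers-∷⁻ : ∀ {a l} → (∀ b → P b → b ∈ a ∷ l) → ∀ b → (P ∩ ∁ ｛ a ｝) b → b ∈ l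
  covers-∷⁻ covers b (p , a≢b) with covers b p
  ... | here b≡a  = ⊥-elim (a≢b (sym b≡a))
  ... | there b∈l = b∈l

  module _ (em : ExcludedMiddle) where

    listed⇒enumeration : (l : List A) → (∀ a → P a → a ∈ l) → ∃ (Enumeration P)
    listed⇒enumeration [] covers = 0 , enumeration-empty λ a p → case covers a p of λ ()
    listed⇒enumeration {P} (a ∷ l) covers
      with listed⇒enumeration {P ∩ ∁ ｛ a ｝} l (covers-∷⁻ covers) | em (P a)
    ... | n , e | yes pa =
      suc n , enumeration-resp (split , unsplit) (enumeration-insert (λ (_ , a≢a) → a≢a refl) e)
      where
      split : (P ∩ ∁ ｛ a ｝) ∪ ｛ a ｝ ⊆ P
      split (inj₁ (p , _)) = p
      split (inj₂ refl)    = pa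

      unsplit : P ⊆ (P ∩ ∁ ｛ a ｝) ∪ ｛ a ｝
      unsplit {b} p with em (a ≡ b)
      ... | yes a≡b = inj₂ a≡b
      ... | no a≢b  = inj₁ (p , a≢b)
    ... | n , e | no ¬pa = n , enumeration-resp (proj₁ , λ p → p , λ { refl → ¬pa p }) e

    finite⇒enumeration : FinitelyMany P → ∃ (Enumeration P)
    finite⇒enumeration (l , covers) = listed⇒enumeration l covers

module Coordinates (𝔄 : Str) where
  open Str 𝔄
  open Enumeration
  open PredInjection

  Coord : Dir → A → ℕ → Set
  Coord X a = Enumeration (E X a)

  module Successor (ax₁ : φ1 𝔄) (ax₂ : φ2 𝔄) (ax₅ : φ5 𝔄) (ax₆ : φ6 𝔄) where

    o : A
    o = proj₁ (proj₁ ax₁)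

    o-O : O o
    o-O = proj₁ (proj₂ (proj₁ ax₁))

    O-unique : ∀ x → O x → x ≡ o
    O-unique = proj₂ (proj₂ (proj₁ ax₁))

    o-no-E-predecessor : ∀ X y → ¬ E X y o
    o-no-E-predecessor hor y = proj₁ (ax₂ o o-O y)
    o-no-E-predecessor ver y = proj₂ (ax₂ o o-O y)

    coord-suc : ∀ X {y z n} → Adj X y z → Coord X y n → Coord X z (suc n)
    coord-suc X {y} {z} y→z ey = transport with-O forth back
      where
      with-O : Enumeration (E X y ∪ O) _
      with-O = enumeration-resp
        ( (λ { (inj₁ e) → inj₁ e ; (inj₂ refl) → inj₂ o-O })
        , (λ { (inj₁ e) → inj₁ e ; (inj₂ ox) → inj₂ (sym (O-unique _ ox)) }) )
        (enumeration-insert (o-no-E-predecessor X y) ey)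

      forth : PredInjection (E X y ∪ O) (E X z)
      forth = relation-injection {T = λ x w → S X x y z w}
        (λ x p → ax₅ X x y z (p , y→z))
        (λ w e → exactlyOne⇒atMostOne (ax₆ X w z y (e , y→z)))

      back : PredInjection (E X z) (E X y ∪ O)
      back = relation-injection {T = λ w x → S X x y z w}
        (λ w e → ax₆ X w z y (e , y→z))
        (λ x p → exactlyOne⇒atMostOne (ax₅ X x y z (p , y→z)))

  module Comparison (ax₉ : φ9 𝔄) (ax₁₀ : φ10 𝔄) where

    ≼-injection : ∀ X {y z} → Pre X y z → PredInjection (E X y) (E X z)
    ≼-injection X {y} {z} y≼z = relation-injection {T = λ x w → R X x y z w}
      (λ x e → ax₉ X x y z (y≼z , e))
      (λ w e → ax₁₀ X w z y (y≼z , e))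

    ≼-injection-R : ∀ X {y z} (y≼z : Pre X y z) x (e : E X y x) →
                    R X x y z (map (≼-injection X y≼z) x e)
    ≼-injection-R X {y} {z} y≼z = relation-map-rel {T = λ x w → R X x y z w}
      (λ x e → ax₉ X x y z (y≼z , e))
      (λ w e → ax₁₀ X w z y (y≼z , e))

    coord-≃ : ∀ X {y z n} → Pre X y z → Pre X z y → Coord X y n → Coord X z n
    coord-≃ X y≼z z≼y ey = transport ey (≼-injection X y≼z) (≼-injection X z≼y)

  module Sideways (ax₇ : φ7 𝔄) (ax₉ : φ9 𝔄) (ax₁₀ : φ10 𝔄) where
    open Comparison ax₉ ax₁₀

    coord-other : ∀ X {y z n} → Adj X y z → Coord (other X) y n → Coord (other X) z n
    coord-other X {y} {z} y→z = coord-≃ (other X) (proj₁ (ax₇ X y z y→z)) (proj₂ (ax₇ X y z y→z))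

  module Identification (ax₈ : φ8 𝔄) (ax₉ : φ9 𝔄) (ax₁₀ : φ10 𝔄) (ax₁₁ : φ11 𝔄) (ax₁₂ : φ12 𝔄)
                        (ax₁₃ : φ13 𝔄) where
    open Comparison ax₉ ax₁₀

    equal-coord⇒≽ : ∀ X {y z n} → G y → G z → Coord X y n → Coord X z n → Pre X z y
    equal-coord⇒≽ X {y} {z} gy gz ey ez with ax₈ X y z (gy , gz)
    ... | inj₂ z≼y = z≼y
    ... | inj₁ y≼z = ax₁₂ X y z (gy , gz , λ w e → Equivalence.from (ax₁₁ X w z y) (unique-preimage w e))
      where
      unique-preimage : ∀ w → E X z w → ExactlyOne λ x → E X y x × R X x y z w
      unique-preimage w e with k , image-k≡w ← injection-surjective ey ez (≼-injection X y≼z) w e =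
        elem ey k , preimage-k , λ x p → ax₁₀ X w z y (y≼z , e) x (elem ey k) p preimage-k
        where
        preimage-k : E X y (elem ey k) × R X (elem ey k) y z w
        preimage-k = elem-∈ ey k
                   , subst (R X (elem ey k) y z) image-k≡w (≼-injection-R X y≼z _ (elem-∈ ey k))

    equal-coords⇒≡ : ∀ {y z m n} → G y → G z → Coord hor y n → Coord hor z n →
                     Coord ver y m → Coord ver z m → y ≡ z
    equal-coords⇒≡ {y} {z} gy gz hy hz vy vz =
      trans (unique y (equivalent gy gy hy hy vy vy)) (sym (unique z (equivalent gy gz hy hz vy vz)))
      where
      unique = proj₂ (proj₂ (ax₁₃ y gy))

      equivalent : ∀ {a b m n} → G a → G b → Coord hor a n → Coord hor b n →
                   Coord ver a m → Coord ver b m →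
                   (Pre hor a b × Pre hor b a) × (Pre ver a b × Pre ver b a)
      equivalent ga gb ha hb va vb =
        (equal-coord⇒≽ hor gb ga hb ha , equal-coord⇒≽ hor ga gb ha hb) ,
        (equal-coord⇒≽ ver gb ga vb va , equal-coord⇒≽ ver ga gb va vb)

module Grid (𝔄 : Str) (ax₁ : φ1 𝔄) (ax₂ : φ2 𝔄) (ax₃ : φ3 𝔄) (ax₄ : φ4 𝔄) (ax₅ : φ5 𝔄)
            (ax₆ : φ6 𝔄) (ax₇ : φ7 𝔄) (ax₈ : φ8 𝔄) (ax₉ : φ9 𝔄) (ax₁₀ : φ10 𝔄) (ax₁₁ : φ11 𝔄)
            (ax₁₂ : φ12 𝔄) (ax₁₃ : φ13 𝔄) where
  open Str 𝔄
  open Coordinates 𝔄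
  open Successor ax₁ ax₂ ax₅ ax₆
  open Sideways ax₇ ax₉ ax₁₀
  open Identification ax₈ ax₉ ax₁₀ ax₁₁ ax₁₂ ax₁₃

  GPoint : Set
  GPoint = Σ A G

  origin : GPoint
  origin = proj₁ ax₃ , proj₁ (proj₁ (proj₂ ax₃))

  coord-origin : ∀ X → Coord X (proj₁ origin) 0
  coord-origin hor = enumeration-empty λ a → proj₁ (proj₂ (proj₁ (proj₂ ax₃)) a)
  coord-origin ver = enumeration-empty λ a → proj₂ (proj₂ (proj₁ (proj₂ ax₃)) a)

  successor : ∀ X (a : GPoint) → ExactlyOne λ b → Adj X (proj₁ a) b × G b
  successor hor (a , ga) = proj₁ (ax₄ a ga)
  successor ver (a , ga) = proj₂ (ax₄ a ga)

  next : Dir → GPoint → GPoint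
  next X a = proj₁ (successor X a) , proj₂ (proj₁ (proj₂ (successor X a)))

  next-adj : ∀ X a → Adj X (proj₁ a) (proj₁ (next X a))
  next-adj X a = proj₁ (proj₁ (proj₂ (successor X a)))

  next-unique : ∀ X a {b} → Adj X (proj₁ a) b → G b → b ≡ proj₁ (next X a)
  next-unique X a {b} a→b gb = proj₂ (proj₂ (successor X a)) b (a→b , gb)

  grid : ℕ → ℕ → GPoint
  grid i       (suc j) = next hor (grid i j)
  grid zero    zero    = origin
  grid (suc i) zero    = next ver (grid i zero)

  node : ℕ × ℕ → A
  node (i , j) = proj₁ (grid i j)

  node-G : ∀ p → G (node p)
  node-G (i , j) = proj₂ (grid i j)

  coord-hor : ∀ i j → Coord hor (node (i , j)) j
  coord-hor i       (suc j) = coord-suc hor (next-adj hor (grid i j)) (coord-hor i j)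
  coord-hor zero    zero    = coord-origin hor
  coord-hor (suc i) zero    = coord-other ver (next-adj ver (grid i zero)) (coord-hor i zero)

  coord-ver : ∀ i j → Coord ver (node (i , j)) i
  coord-ver i       (suc j) = coord-other hor (next-adj hor (grid i j)) (coord-ver i j)
  coord-ver zero    zero    = coord-origin ver
  coord-ver (suc i) zero    = coord-suc ver (next-adj ver (grid i zero)) (coord-ver i zero)

  next-ver≡node : ∀ i j → proj₁ (next ver (grid i j)) ≡ node (suc i , j)
  next-ver≡node i j = equal-coords⇒≡ (proj₂ (next ver (grid i j))) (node-G (suc i , j))
    (coord-other ver (next-adj ver (grid i j)) (coord-hor i j)) (coord-hor (suc i) j)
    (coord-suc ver (next-adj ver (grid i j)) (coord-ver i j)) (coord-ver (suc i) j)

  node-ver : ∀ i j → Adj ver (node (i , j)) (node (suc i , j))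
  node-ver i j = subst (Adj ver (node (i , j))) (next-ver≡node i j) (next-adj ver (grid i j))

  node-injective : ∀ p q → node p ≡ node q → p ≡ q
  node-injective (i , j) (i′ , j′) eq = cong₂ _,_
    (size-unique (subst (λ a → Coord ver a i) eq (coord-ver i j)) (coord-ver i′ j′))
    (size-unique (subst (λ a → Coord hor a j) eq (coord-hor i j)) (coord-hor i′ j′))

  node-hor-iff : ∀ p q → Adj hor (node p) (node q) ⇔ GH p q
  node-hor-iff (i , j) (i′ , j′) = mk⇔
    (λ p→q → ,-injective (node-injective (i′ , j′) (i , suc j)
                           (next-unique hor (grid i j) p→q (node-G (i′ , j′)))))
    (λ { (refl , refl) → next-adj hor (grid i j) })

  node-ver-iff : ∀ p q → Adj ver (node p) (node q) ⇔ GV p q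
  node-ver-iff (i , j) (i′ , j′) = mk⇔
    (λ p→q → ,-injective (node-injective (i′ , j′) (suc i , j)
                           (trans (next-unique ver (grid i j) p→q (node-G (i′ , j′)))
                                  (next-ver≡node i j))))
    (λ { (refl , refl) → node-ver i j })

  gridLike : GridLike 𝔄
  gridLike = (λ i j → node (i , j)) , λ i j → node-G (i , j) , next-adj hor (grid i j) , node-ver i j

  node-surjective : ExcludedMiddle → χ 𝔄 → ∀ a → G a → ∃ λ p → node p ≡ a
  node-surjective em finite a ga
    with j , ha ← finite⇒enumeration em (finite hor a)
       | i , va ← finite⇒enumeration em (finite ver a)
    = (i , j) , equal-coords⇒≡ (node-G (i , j)) ga (coord-hor i j) ha (coord-ver i j) va

  isGrid : ExcludedMiddle → χ 𝔄 → IsGrid 𝔄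
  isGrid em finite =
    node , node-G , node-injective , node-surjective em finite , node-hor-iff , node-ver-iff

lemma11 : ExcludedMiddle → (𝔄 : Str) → φ 𝔄 → GridLike 𝔄 × (χ 𝔄 → IsGrid 𝔄)
lemma11 em 𝔄 (ax₁ , ax₂ , ax₃ , ax₄ , ax₅ , ax₆ , ax₇ , ax₈ , ax₉ , ax₁₀ , ax₁₁ , ax₁₂ , ax₁₃) =
  gridLike , isGrid em
  where open Grid 𝔄 ax₁ ax₂ ax₃ ax₄ ax₅ ax₆ ax₇ ax₈ ax₉ ax₁₀ ax₁₁ ax₁₂ ax₁₃
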